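{- Let $C(x)$ and $C_w(x)$ denote the numbers of Carmichael numbers and of weak Carmichael numbers in the interval $[1,x]$, respectively. Then $\lim_{x\to\infty}\bigl(C_w(x)-C(x)\bigr)=+\infty$.
   Context: A Carmichael number is a composite positive integer $n$ with $a^{n-1}\equiv 1\pmod n$ for all integers $a$ coprime to $n$. A composite positive integer $n$ is called a weak Carmichael number if $\sum_{1\le k\le n-1,\ \gcd(k,n)=1} k^{n-1}\equiv \varphi(n)\pmod{n}$, where $\varphi$ is Euler's totient function. -}

module Defs where

open import Data.Nat using (ℕ; suc; _∸_; _≤_)
import Data.Nat as ℕ
open import Data.Nat.Primality using (Composite)
open import Data.Nat.Coprimality using (Coprime; coprime?)
open import Data.Integer using (ℤ; +_; _-_; ∣_∣)
import Data.Integer as ℤ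
open import Data.Integer.Divisibility using (_∣_)
open import Data.List using (List; upTo; map; filter; length)
open import Data.Nat.ListAction using (sum)
open import Data.Product using (_×_)
open import Relation.Unary using (Pred; Decidable)
open import Level using (0ℓ)

range1 : ℕ → List ℕ
range1 m = map suc (upTo m)

φ : ℕ → ℕ
φ n = length (filter (λ k → coprime? k n) (range1 n))

IsCarmichael : ℕ → Set
IsCarmichael n = Composite n × ((a : ℤ) → Coprime ∣ a ∣ n → (+ n) ∣ (a ℤ.^ (n ∸ 1) - + 1))

weakSum : ℕ → ℕ
weakSum n = sum (map (λ k → k ℕ.^ (n ∸ 1)) (filter (λ k → coprime? k n) (range1 (n ∸ 1))))

IsWeakCarmichael : ℕ → Set
IsWeakCarmichael n = Composite n × ((+ n) ∣ (+ weakSum n - + φ n))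

count : {P : Pred ℕ 0ℓ} → Decidable P → ℕ → ℕ
count P? x = length (filter P? (range1 x))

-- Every Carmichael number is a weak Carmichael number: if k^(n-1) ≡ 1 (mod n) for each k
-- coprime to n, the sum of these powers is ≡ φ(n). So Cw(x) - C(x) counts the weak Carmichael
-- numbers up to x that are not Carmichael, and it suffices to exhibit infinitely many of them:
-- the powers n = 3^(m+2). The residues coprime to n are 3q+1 and 3q+2 (q < T = n/3), a first-order
-- binomial expansion gives Σ_{q<T} (3q+r)^(n-1) ≡ T r^(n-1) (mod n), and 2^(n-1) ≡ 1 (mod 3) as
-- n-1 is even; so the weak sum is ≡ T + T = φ(n). But 2^(n-1) ≡ 4 (mod 9), so n is not Carmichael.
module Submission where

open import Defs
open import Data.Nat using (ℕ; zero; suc; _+_; _*_; _∸_; _^_; _≤_; _<_; _≤′_; ≤′-refl; ≤′-step; z≤n; s≤s; nonTrivial⇒n>1)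
open import Data.Nat.Properties
open import Data.Nat.Divisibility using (_∣_; divides; ∣-refl; ∣-trans; ∣m⇒∣m*n; ∣m∣n⇒∣m+n; ∣m+n∣m⇒∣n; ∣⇒≤)
open import Data.Nat.Coprimality using (Coprime; coprime?; coprime-divisor; coprime-+; 1-coprimeTo)
import Data.Nat.Coprimality as Coprime
open import Data.Nat.Primality using (Composite; composite; composite⇒nonTrivial)
open import Data.Nat.ListAction using (sum)
open import Data.Nat.ListAction.Properties using (sum-++)
open import Data.Nat.Tactic.RingSolver using (solve; solve-∀)
open import Data.Integer using (ℤ; +_; _-_; ∣_∣)
import Data.Integer as ℤ
import Data.Integer.Properties as ℤ
import Data.Integer.Divisibility as ℤ∣
import Data.Integer.Divisibility.Signed as ℤ∣ˢ
import Data.Integer.Tactic.RingSolver as ℤ-Solver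
open import Data.List using (List; []; _∷_; _++_; _∷ʳ_; map; filter; length; upTo)
open import Data.List.Properties using (filter-++; filter-accept; filter-reject; map-++; length-++; upTo-∷ʳ; ∷ʳ-++; ++-identityʳ)
open import Data.List.Relation.Unary.All as All using (All)
open import Data.List.Relation.Unary.All.Properties using (all-filter)
open import Data.Product using (∃; _,_; _×_)
open import Function using (_∘_)
open import Relation.Nullary using (¬_; yes; no)
open import Relation.Unary using (Pred; Decidable; _⊆_)
open import Relation.Binary.PropositionalEquality
open import Level using (0ℓ)

sumBelow : (ℕ → ℕ) → ℕ → ℕ
sumBelow f zero    = 0
sumBelow f (suc n) = sumBelow f n + f n

sumBelow-cong : ∀ {f g} n → (∀ q → f q ≡ g q) → sumBelow f n ≡ sumBelow g n
sumBelow-cong zero    f≗g = refl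
sumBelow-cong (suc n) f≗g = cong₂ _+_ (sumBelow-cong n f≗g) (f≗g n)

sumBelow-+ : ∀ f g n → sumBelow (λ q → f q + g q) n ≡ sumBelow f n + sumBelow g n
sumBelow-+ f g zero    = refl
sumBelow-+ f g (suc n) rewrite sumBelow-+ f g n = interchange (sumBelow f n) (sumBelow g n) (f n) (g n)
  where
  interchange : ∀ a b c d → a + b + (c + d) ≡ a + c + (b + d)
  interchange = solve-∀

sumBelow-split : ∀ f m n → sumBelow f (m + n) ≡ sumBelow f m + sumBelow (λ q → f (m + q)) n
sumBelow-split f m zero    = trans (cong (sumBelow f) (+-identityʳ m)) (sym (+-identityʳ _))
sumBelow-split f m (suc n) rewrite +-suc m n | sumBelow-split f m n = +-assoc (sumBelow f m) _ _

sumBelow-3* : ∀ f n → sumBelow f (3 * n) ≡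
  sumBelow f n + (sumBelow (λ q → f (n + q)) n + sumBelow (λ q → f (n + (n + q))) n)
sumBelow-3* f n = begin
  sumBelow f (n + (n + (n + 0)))
    ≡⟨ sumBelow-split f n (n + (n + 0)) ⟩
  sumBelow f n + sumBelow (λ q → f (n + q)) (n + (n + 0))
    ≡⟨ cong (_+_ (sumBelow f n)) (sumBelow-split (λ q → f (n + q)) n (n + 0)) ⟩
  sumBelow f n + (sumBelow (λ q → f (n + q)) n + sumBelow (λ q → f (n + (n + q))) (n + 0))
    ≡⟨ cong (λ m → sumBelow f n + (sumBelow (λ q → f (n + q)) n + sumBelow (λ q → f (n + (n + q))) m)) (+-identityʳ n) ⟩
  sumBelow f n + (sumBelow (λ q → f (n + q)) n + sumBelow (λ q → f (n + (n + q))) n) ∎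
  where open ≡-Reasoning

-- The derivative of a ↦ a ^ e, written so that no truncated subtraction e ∸ 1 appears.
∂pow : ℕ → ℕ → ℕ
∂pow a zero    = 0
∂pow a (suc e) = suc e * a ^ e

*-∂pow : ∀ a e → a * ∂pow a e ≡ e * a ^ e
*-∂pow a zero    = *-zeroʳ a
*-∂pow a (suc e) = x[yz]≡y[xz] a (suc e) (a ^ e)
  where
  x[yz]≡y[xz] : ∀ x y z → x * (y * z) ≡ y * (x * z)
  x[yz]≡y[xz] = solve-∀

^-+-firstOrder : ∀ a x e → ∃ λ c → (a + x) ^ e ≡ a ^ e + x * ∂pow a e + x * x * c
^-+-firstOrder a x zero    = 0 , solve (x ∷ [])
^-+-firstOrder a x (suc e) with ^-+-firstOrder a x e
... | c , eq = a * c + ∂pow a e + x * c , (begin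
  (a + x) * (a + x) ^ e
    ≡⟨ cong ((a + x) *_) eq ⟩
  (a + x) * (a ^ e + x * ∂pow a e + x * x * c)
    ≡⟨ expand a x (a ^ e) (∂pow a e) c ⟩
  a * a ^ e + x * (a ^ e + a * ∂pow a e) + x * x * (a * c + ∂pow a e + x * c)
    ≡⟨ cong (λ y → a * a ^ e + x * (a ^ e + y) + x * x * (a * c + ∂pow a e + x * c)) (*-∂pow a e) ⟩
  a * a ^ e + x * (a ^ e + e * a ^ e) + x * x * (a * c + ∂pow a e + x * c) ∎)
  where
  open ≡-Reasoning
  expand : ∀ a x A D c → (a + x) * (A + x * D + x * x * c) ≡ a * A + x * (A + a * D) + x * x * (a * c + D + x * c)
  expand = solve-∀

sumBelow-^-+-firstOrder : ∀ (a : ℕ → ℕ) x e n → ∃ λ c →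
  sumBelow (λ q → (a q + x) ^ e) n ≡ sumBelow (λ q → a q ^ e) n + x * sumBelow (λ q → ∂pow (a q) e) n + x * x * c
sumBelow-^-+-firstOrder a x e zero = 0 , solve (x ∷ [])
sumBelow-^-+-firstOrder a x e (suc n)
  with sumBelow-^-+-firstOrder a x e n | ^-+-firstOrder (a n) x e
... | C , eqˢ | c , eq = C + c , trans (cong₂ _+_ eqˢ eq) (regroup S D (a n ^ e) (∂pow (a n) e) x C c)
  where
  S = sumBelow (λ q → a q ^ e) n
  D = sumBelow (λ q → ∂pow (a q) e) n
  regroup : ∀ S D A d x C c → S + x * D + x * x * C + (A + x * d + x * x * c) ≡ S + A + x * (D + d) + x * x * (C + c)
  regroup = solve-∀

-- Split the range into three blocks of length T = 3^k: the second and third are the first with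
-- r replaced by r + 3T and r + 6T, whose first-order terms 3T·∂S + 6T·∂S = 9T·∂S vanish mod 9T.
sumBelow-^-progression : ∀ k r e → ∃ λ c → sumBelow (λ q → (r + 3 * q) ^ e) (3 ^ k) ≡ 3 ^ k * r ^ e + 3 ^ suc k * c
sumBelow-^-progression zero r e =
  0 , trans (cong (_^ e) (+-identityʳ r)) (sym (trans (+-identityʳ _) (+-identityʳ (r ^ e))))
sumBelow-^-progression (suc k) r e
  with sumBelow-^-progression k r e
     | sumBelow-^-+-firstOrder (λ q → r + 3 * q) (3 * 3 ^ k) e (3 ^ k)
     | sumBelow-^-+-firstOrder (λ q → r + 3 * q) (2 * (3 * 3 ^ k)) e (3 ^ k)
... | c , eq | C₁ , eq₁ | C₂ , eq₂ = c + ∂S + T * (C₁ + 4 * C₂) , (begin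
  sumBelow f (3 * T)
    ≡⟨ sumBelow-3* f T ⟩
  sumBelow f T + (sumBelow (λ q → f (T + q)) T + sumBelow (λ q → f (T + (T + q))) T)
    ≡⟨ cong₂ (λ u v → sumBelow f T + (u + v)) (trans (sumBelow-cong T shift₁) eq₁) (trans (sumBelow-cong T shift₂) eq₂) ⟩
  S + ((S + 3 * T * ∂S + 3 * T * (3 * T) * C₁) + (S + 2 * (3 * T) * ∂S + 2 * (3 * T) * (2 * (3 * T)) * C₂))
    ≡⟨ cong (λ s → s + ((s + 3 * T * ∂S + 3 * T * (3 * T) * C₁) + (s + 2 * (3 * T) * ∂S + 2 * (3 * T) * (2 * (3 * T)) * C₂))) eq ⟩
  _ ≡⟨ regroup T (r ^ e) c ∂S C₁ C₂ ⟩
  3 * T * r ^ e + 3 * (3 * T) * (c + ∂S + T * (C₁ + 4 * C₂)) ∎)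
  where
  open ≡-Reasoning
  T = 3 ^ k
  f : ℕ → ℕ
  f q = (r + 3 * q) ^ e
  S = sumBelow f T
  ∂S = sumBelow (λ q → ∂pow (r + 3 * q) e) T
  shift₁-lemma : ∀ r q T → r + 3 * (T + q) ≡ r + 3 * q + 3 * T
  shift₁-lemma = solve-∀
  shift₂-lemma : ∀ r q T → r + 3 * (T + (T + q)) ≡ r + 3 * q + 2 * (3 * T)
  shift₂-lemma = solve-∀
  shift₁ : ∀ q → f (T + q) ≡ (r + 3 * q + 3 * T) ^ e
  shift₁ q = cong (_^ e) (shift₁-lemma r q T)
  shift₂ : ∀ q → f (T + (T + q)) ≡ (r + 3 * q + 2 * (3 * T)) ^ e
  shift₂ q = cong (_^ e) (shift₂-lemma r q T)
  regroup : ∀ T R c D C₁ C₂ →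
    T * R + 3 * T * c + ((T * R + 3 * T * c + 3 * T * D + 3 * T * (3 * T) * C₁)
                         + (T * R + 3 * T * c + 2 * (3 * T) * D + 2 * (3 * T) * (2 * (3 * T)) * C₂))
    ≡ 3 * T * R + 3 * (3 * T) * (c + D + T * (C₁ + 4 * C₂))
  regroup = solve-∀

[1+d]^n≡1+d*w : ∀ d n → ∃ λ w → (1 + d) ^ n ≡ 1 + d * w
[1+d]^n≡1+d*w d zero = 0 , solve (d ∷ [])
[1+d]^n≡1+d*w d (suc n) with [1+d]^n≡1+d*w d n
... | w , eq = 1 + w + d * w , trans (cong ((1 + d) *_) eq) (solve (d ∷ w ∷ []))

-- 3^(k+1) - 1 = 2 + 6u with 3^k = 1 + 2u, so 2^(3^(k+1) - 1) = 4·64^u and 64^u ≡ 1 (mod 63).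
2^[3^[1+k]∸1]≡4+252w : ∀ k → ∃ λ w → 2 ^ (3 ^ suc k ∸ 1) ≡ 4 + 252 * w
2^[3^[1+k]∸1]≡4+252w k with [1+d]^n≡1+d*w 2 k
... | u , 3^k≡1+2u with [1+d]^n≡1+d*w 63 u
... | w , 64^u≡1+63w = w , (begin
  2 ^ (3 * 3 ^ k ∸ 1)      ≡⟨ cong (λ t → 2 ^ (3 * t ∸ 1)) 3^k≡1+2u ⟩
  2 ^ (3 * (1 + 2 * u) ∸ 1) ≡⟨ cong (λ t → 2 ^ (t ∸ 1)) (3[1+2u]≡3+6u u) ⟩
  2 ^ (2 + 6 * u)           ≡⟨ ^-distribˡ-+-* 2 2 (6 * u) ⟩
  4 * 2 ^ (6 * u)           ≡⟨ cong (4 *_) (sym (^-*-assoc 2 6 u)) ⟩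
  4 * 64 ^ u                ≡⟨ cong (4 *_) 64^u≡1+63w ⟩
  4 * (1 + 63 * w)          ≡⟨ solve (w ∷ []) ⟩
  4 + 252 * w ∎)
  where
  open ≡-Reasoning
  3[1+2u]≡3+6u : ∀ u → 3 * (1 + 2 * u) ≡ 3 + 6 * u
  3[1+2u]≡3+6u = solve-∀

coprime-* : ∀ {a b c} → Coprime a b → Coprime a c → Coprime a (b * c)
coprime-* {b = b} a⊥b a⊥c (d∣a , d∣bc) = a⊥c (d∣a , coprime-divisor d⊥b d∣bc)
  where
  d⊥b : Coprime _ b
  d⊥b (e∣d , e∣b) = a⊥b (∣-trans e∣d d∣a , e∣b)

coprime-^ : ∀ {a b} → Coprime a b → ∀ m → Coprime a (b ^ m)
coprime-^ {a} a⊥b zero = Coprime.sym (1-coprimeTo a)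
coprime-^ a⊥b (suc m) = coprime-* a⊥b (coprime-^ a⊥b m)

∣m+n∣n⇒∣m : ∀ {d m n} → d ∣ m + n → d ∣ n → d ∣ m
∣m+n∣n⇒∣m {d} {m} {n} d∣m+n = ∣m+n∣m⇒∣n (subst (d ∣_) (+-comm m n) d∣m+n)

coprime-+-* : ∀ {r n} → Coprime r n → ∀ q → Coprime (r + n * q) n
coprime-+-* r⊥n q (d∣r+nq , d∣n) = r⊥n (∣m+n∣n⇒∣m d∣r+nq (∣m⇒∣m*n q d∣n) , d∣n)

2-coprimeTo-3 : Coprime 2 3
2-coprimeTo-3 = Coprime.sym (coprime-+ (1-coprimeTo 2))

common-divisor⇒¬coprime : ∀ {d a b} → 1 < d → d ∣ a → d ∣ b → ¬ Coprime a b
common-divisor⇒¬coprime 1<d d∣a d∣b a⊥b = <⇒≢ 1<d (sym (a⊥b (d∣a , d∣b)))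

range1-suc : ∀ x → range1 (suc x) ≡ range1 x ∷ʳ suc x
range1-suc x = trans (cong (map suc) (sym (upTo-∷ʳ x))) (map-++ suc (upTo x) (x ∷ []))

module _ {P : Pred ℕ 0ℓ} (P? : Decidable P) where

  filter-range1-suc : ∀ x → filter P? (range1 (suc x)) ≡ filter P? (range1 x) ++ filter P? (suc x ∷ [])
  filter-range1-suc x = trans (cong (filter P?) (range1-suc x)) (filter-++ P? (range1 x) (suc x ∷ []))

  filter-range1-accept : ∀ {x} → P (suc x) → filter P? (range1 (suc x)) ≡ filter P? (range1 x) ∷ʳ suc x
  filter-range1-accept {x} p = trans (filter-range1-suc x) (cong (filter P? (range1 x) ++_) (filter-accept P? p))

  filter-range1-reject : ∀ {x} → ¬ P (suc x) → filter P? (range1 (suc x)) ≡ filter P? (range1 x)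
  filter-range1-reject {x} ¬p =
    trans (filter-range1-suc x) (trans (cong (filter P? (range1 x) ++_) (filter-reject P? ¬p)) (++-identityʳ _))

  count-accept : ∀ {x} → P (suc x) → count P? (suc x) ≡ suc (count P? x)
  count-accept {x} p =
    trans (cong length (filter-range1-accept p)) (trans (length-++ (filter P? (range1 x))) (+-comm (count P? x) 1))

  count-reject : ∀ {x} → ¬ P (suc x) → count P? (suc x) ≡ count P? x
  count-reject ¬p = cong length (filter-range1-reject ¬p)

coprimesUpTo : ℕ → ℕ → List ℕ
coprimesUpTo n x = filter (λ k → coprime? k n) (range1 x)

coprimesUpTo-pred : ∀ n → 1 < n → coprimesUpTo n n ≡ coprimesUpTo n (n ∸ 1)
coprimesUpTo-pred (suc m) 1<n = filter-range1-reject (λ k → coprime? k (suc m)) (common-divisor⇒¬coprime 1<n ∣-refl ∣-refl)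

nonMultiplesOf3 : ℕ → List ℕ
nonMultiplesOf3 zero    = []
nonMultiplesOf3 (suc q) = nonMultiplesOf3 q ++ (1 + 3 * q ∷ 2 + 3 * q ∷ [])

coprimesUpTo-3^ : ∀ m q → coprimesUpTo (3 ^ suc m) (3 * q) ≡ nonMultiplesOf3 q
coprimesUpTo-3^ m zero    = refl
coprimesUpTo-3^ m (suc q) = begin
  coprimesUpTo n (3 * suc q)                          ≡⟨ cong (coprimesUpTo n) (*-suc 3 q) ⟩
  coprimesUpTo n (3 + 3 * q)                          ≡⟨ filter-range1-reject ⊥n? multiple-of-3 ⟩
  coprimesUpTo n (2 + 3 * q)                          ≡⟨ filter-range1-accept ⊥n? (coprimeTo3^ 2-coprimeTo-3) ⟩
  coprimesUpTo n (1 + 3 * q) ∷ʳ (2 + 3 * q)           ≡⟨ cong (_∷ʳ (2 + 3 * q)) (filter-range1-accept ⊥n? (coprimeTo3^ (1-coprimeTo 3))) ⟩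
  coprimesUpTo n (3 * q) ∷ʳ (1 + 3 * q) ∷ʳ (2 + 3 * q) ≡⟨ ∷ʳ-++ (coprimesUpTo n (3 * q)) (1 + 3 * q) (2 + 3 * q ∷ []) ⟩
  coprimesUpTo n (3 * q) ++ (1 + 3 * q ∷ 2 + 3 * q ∷ []) ≡⟨ cong (_++ (1 + 3 * q ∷ 2 + 3 * q ∷ [])) (coprimesUpTo-3^ m q) ⟩
  nonMultiplesOf3 (suc q) ∎
  where
  open ≡-Reasoning
  n = 3 ^ suc m
  ⊥n? : Decidable (λ k → Coprime k n)
  ⊥n? k = coprime? k n
  coprimeTo3^ : ∀ {r} → Coprime r 3 → Coprime (r + 3 * q) n
  coprimeTo3^ r⊥3 = coprime-^ (coprime-+-* r⊥3 q) (suc m)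
  multiple-of-3 : ¬ Coprime (3 + 3 * q) n
  multiple-of-3 = common-divisor⇒¬coprime (s≤s (s≤s z≤n))
    (∣m∣n⇒∣m+n {m = 3} {n = 3 * q} ∣-refl (∣m⇒∣m*n q ∣-refl)) (∣m⇒∣m*n (3 ^ m) (∣-refl {3}))

length-nonMultiplesOf3 : ∀ q → length (nonMultiplesOf3 q) ≡ 2 * q
length-nonMultiplesOf3 zero    = refl
length-nonMultiplesOf3 (suc q) = begin
  length (nonMultiplesOf3 q ++ (1 + 3 * q ∷ 2 + 3 * q ∷ [])) ≡⟨ length-++ (nonMultiplesOf3 q) ⟩
  length (nonMultiplesOf3 q) + 2                             ≡⟨ cong (_+ 2) (length-nonMultiplesOf3 q) ⟩
  2 * q + 2                                                  ≡⟨ solve (q ∷ []) ⟩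
  2 * suc q ∎
  where open ≡-Reasoning

sum-map-nonMultiplesOf3 : ∀ f q → sum (map f (nonMultiplesOf3 q)) ≡ sumBelow (λ i → f (1 + 3 * i) + f (2 + 3 * i)) q
sum-map-nonMultiplesOf3 f zero    = refl
sum-map-nonMultiplesOf3 f (suc q) = begin
  sum (map f (nonMultiplesOf3 q ++ (1 + 3 * q ∷ 2 + 3 * q ∷ [])))
    ≡⟨ cong sum (map-++ f (nonMultiplesOf3 q) _) ⟩
  sum (map f (nonMultiplesOf3 q) ++ (f (1 + 3 * q) ∷ f (2 + 3 * q) ∷ []))
    ≡⟨ sum-++ (map f (nonMultiplesOf3 q)) _ ⟩
  sum (map f (nonMultiplesOf3 q)) + (f (1 + 3 * q) + (f (2 + 3 * q) + 0))
    ≡⟨ cong₂ (λ s t → s + (f (1 + 3 * q) + t)) (sum-map-nonMultiplesOf3 f q) (+-identityʳ _) ⟩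
  sumBelow (λ i → f (1 + 3 * i) + f (2 + 3 * i)) (suc q) ∎
  where open ≡-Reasoning

+-^ : ∀ m e → (+ m) ℤ.^ e ≡ + (m ^ e)
+-^ m zero    = refl
+-^ m (suc e) = trans (cong ((+ m) ℤ.*_) (+-^ m e)) (sym (ℤ.pos-* m (m ^ e)))

[+m]-[+n]≡+[m∸n] : ∀ {m n} → n ≤ m → + m - + n ≡ + (m ∸ n)
[+m]-[+n]≡+[m∸n] {m} {n} n≤m = trans (ℤ.[+m]-[+n]≡m⊖n m n) (ℤ.≤-⊖ n≤m)

m+n≤o⇒+m≤+o-+n : ∀ {m n o} → m + n ≤ o → + m ℤ.≤ + o - + n
m+n≤o⇒+m≤+o-+n {m} {n} {o} m+n≤o =
  subst (+ m ℤ.≤_) (sym ([+m]-[+n]≡+[m∸n] (m+n≤o⇒n≤o m m+n≤o))) (ℤ.+≤+ (m+n≤o⇒m≤o∸n m m+n≤o))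

i≤+∣i∣ : ∀ i → i ℤ.≤ + ∣ i ∣
i≤+∣i∣ (+ n)      = ℤ.≤-refl
i≤+∣i∣ ℤ.-[1+ n ] = ℤ.-≤+

ℤ∣m∣n⇒∣m+n : ∀ {d} i j → d ℤ∣.∣ i → d ℤ∣.∣ j → d ℤ∣.∣ i ℤ.+ j
ℤ∣m∣n⇒∣m+n {d} i j d∣i d∣j = ℤ∣ˢ.∣⇒∣ᵤ {d} {i ℤ.+ j} (ℤ∣ˢ.∣m∣n⇒∣m+n (ℤ∣ˢ.∣ᵤ⇒∣ {d} {i} d∣i) (ℤ∣ˢ.∣ᵤ⇒∣ {d} {j} d∣j))

∣-sum-^-length : ∀ {n e} ks → All (λ k → + n ℤ∣.∣ + (k ^ e) - + 1) ks →
  + n ℤ∣.∣ + sum (map (λ k → k ^ e) ks) - + length ks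
∣-sum-^-length []       All.[]                      = divides 0 refl
∣-sum-^-length {n} {e} (k ∷ ks) (n∣k^e-1 All.∷ n∣rest) =
  subst (+ n ℤ∣.∣_) (sym regroup)
    (ℤ∣m∣n⇒∣m+n {+ n} (+ (k ^ e) - + 1) (+ S - + length ks) n∣k^e-1 (∣-sum-^-length {n} {e} ks n∣rest))
  where
  S = sum (map (λ k → k ^ e) ks)
  ℤ-regroup : ∀ a s l → a ℤ.+ s - (+ 1 ℤ.+ l) ≡ (a - + 1) ℤ.+ (s - l)
  ℤ-regroup = ℤ-Solver.solve-∀
  regroup : + (k ^ e + S) - + (1 + length ks) ≡ (+ (k ^ e) - + 1) ℤ.+ (+ S - + length ks)
  regroup = trans (cong₂ _-_ (ℤ.pos-+ (k ^ e) S) (ℤ.pos-+ 1 (length ks))) (ℤ-regroup (+ (k ^ e)) (+ S) (+ length ks))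

composite⇒1<n : ∀ {n} → Composite n → 1 < n
composite⇒1<n {n} c = nonTrivial⇒n>1 n {{composite⇒nonTrivial c}}

carmichael⇒weakCarmichael : ∀ {n} → IsCarmichael n → IsWeakCarmichael n
carmichael⇒weakCarmichael {n} (c , fermat) =
  c , subst (λ ks → + n ℤ∣.∣ + weakSum n - + length ks) (sym (coprimesUpTo-pred n (composite⇒1<n c)))
        (∣-sum-^-length {n} {n ∸ 1} (coprimesUpTo n (n ∸ 1)) (All.map fermat′ (all-filter (λ k → coprime? k n) (range1 (n ∸ 1)))))
  where
  fermat′ : ∀ {k} → Coprime k n → + n ℤ∣.∣ + (k ^ (n ∸ 1)) - + 1
  fermat′ {k} k⊥n = subst (λ a → + n ℤ∣.∣ a - + 1) (+-^ k (n ∸ 1)) (fermat (+ k) k⊥n)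

composite-3^ : ∀ m → Composite (3 ^ suc (suc m))
composite-3^ m =
  composite (m<m*n 3 (3 ^ suc m) (^-monoʳ-< 3 (s≤s (s≤s z≤n)) {0} {suc m} (s≤s z≤n))) (∣m⇒∣m*n {3} {3} (3 ^ suc m) ∣-refl)

sumBelow-nonMultiplesOf3-^ : ∀ k e w → 2 ^ e ≡ 1 + 3 * w → ∃ λ c →
  sumBelow (λ i → (1 + 3 * i) ^ e + (2 + 3 * i) ^ e) (3 ^ k) ≡ 2 * 3 ^ k + 3 ^ suc k * c
sumBelow-nonMultiplesOf3-^ k e w 2^e≡1+3w with sumBelow-^-progression k 1 e | sumBelow-^-progression k 2 e
... | c₁ , eq₁ | c₂ , eq₂ = w + c₁ + c₂ , (begin
  sumBelow (λ i → (1 + 3 * i) ^ e + (2 + 3 * i) ^ e) T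
    ≡⟨ sumBelow-+ (λ i → (1 + 3 * i) ^ e) (λ i → (2 + 3 * i) ^ e) T ⟩
  sumBelow (λ i → (1 + 3 * i) ^ e) T + sumBelow (λ i → (2 + 3 * i) ^ e) T
    ≡⟨ cong₂ _+_ eq₁ eq₂ ⟩
  T * 1 ^ e + 3 * T * c₁ + (T * 2 ^ e + 3 * T * c₂)
    ≡⟨ cong₂ (λ a b → T * a + 3 * T * c₁ + (T * b + 3 * T * c₂)) (^-zeroˡ e) 2^e≡1+3w ⟩
  T * 1 + 3 * T * c₁ + (T * (1 + 3 * w) + 3 * T * c₂)
    ≡⟨ regroup T c₁ c₂ w ⟩
  2 * T + 3 * T * (w + c₁ + c₂) ∎)
  where
  open ≡-Reasoning
  T = 3 ^ k
  regroup : ∀ T c₁ c₂ w → T * 1 + 3 * T * c₁ + (T * (1 + 3 * w) + 3 * T * c₂) ≡ 2 * T + 3 * T * (w + c₁ + c₂)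
  regroup = solve-∀

weakSum-3^ : ∀ m → ∃ λ c → weakSum (3 ^ suc (suc m)) ≡ φ (3 ^ suc (suc m)) + 3 ^ suc (suc m) * c
weakSum-3^ m =
  let w , 2^E≡4+252w = 2^[3^[1+k]∸1]≡4+252w (suc m)
      c , eq = sumBelow-nonMultiplesOf3-^ (suc m) E (1 + 84 * w) (trans 2^E≡4+252w (4+252w≡1+3[1+84w] w))
  in c , (begin
  weakSum n
    ≡⟨ cong (sum ∘ map (_^ E)) (sym (coprimesUpTo-pred n (composite⇒1<n (composite-3^ m)))) ⟩
  sum (map (_^ E) (coprimesUpTo n n))
    ≡⟨ cong (sum ∘ map (_^ E)) (coprimesUpTo-3^ (suc m) T) ⟩
  sum (map (_^ E) (nonMultiplesOf3 T))
    ≡⟨ sum-map-nonMultiplesOf3 (_^ E) T ⟩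
  sumBelow (λ i → (1 + 3 * i) ^ E + (2 + 3 * i) ^ E) T
    ≡⟨ eq ⟩
  2 * T + n * c
    ≡⟨ cong (_+ n * c) (sym (trans (cong length (coprimesUpTo-3^ (suc m) T)) (length-nonMultiplesOf3 T))) ⟩
  φ n + n * c ∎)
  where
  open ≡-Reasoning
  T = 3 ^ suc m
  n = 3 * T
  E = n ∸ 1
  4+252w≡1+3[1+84w] : ∀ w → 4 + 252 * w ≡ 1 + 3 * (1 + 84 * w)
  4+252w≡1+3[1+84w] = solve-∀

weakCarmichael-3^ : ∀ m → IsWeakCarmichael (3 ^ suc (suc m))
weakCarmichael-3^ m =
  let c , eq = weakSum-3^ m
  in composite-3^ m , subst (λ s → + n ℤ∣.∣ + s - + φ n) (sym eq)
       (subst (+ n ℤ∣.∣_) (sym ([+m+n]-[+m]≡+n (φ n) (n * c))) (∣m⇒∣m*n c ∣-refl))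
  where
  n = 3 ^ suc (suc m)
  [+m+n]-[+m]≡+n : ∀ a b → + (a + b) - + a ≡ + b
  [+m+n]-[+m]≡+n a b = trans ([+m]-[+n]≡+[m∸n] (m≤m+n a b)) (cong +_ (m+n∸m≡n a b))

-- 9 divides n while 2^(n-1) ≡ 4 (mod 9).
¬carmichael-3^ : ∀ m → ¬ IsCarmichael (3 ^ suc (suc m))
¬carmichael-3^ m (_ , fermat) =
  let w , 2^E≡4+252w = 2^[3^[1+k]∸1]≡4+252w (suc m)
      n∣3+252w : n ∣ 3 + 252 * w
      n∣3+252w = subst (λ a → + n ℤ∣.∣ + a - + 1) 2^E≡4+252w n∣2^E-1
  in 9∤3 (∣m+n∣n⇒∣m (∣-trans 9∣n n∣3+252w) (divides (28 * w) (252w≡28w*9 w)))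
  where
  n = 3 ^ suc (suc m)
  n∣2^E-1 : + n ℤ∣.∣ + (2 ^ (n ∸ 1)) - + 1
  n∣2^E-1 = subst (λ a → + n ℤ∣.∣ a - + 1) (+-^ 2 (n ∸ 1))
    (fermat (+ 2) (coprime-^ 2-coprimeTo-3 (suc (suc m))))
  3[3p]≡p*9 : ∀ p → 3 * (3 * p) ≡ p * 9
  3[3p]≡p*9 = solve-∀
  9∣n : 9 ∣ n
  9∣n = divides (3 ^ m) (3[3p]≡p*9 (3 ^ m))
  252w≡28w*9 : ∀ w → 252 * w ≡ 28 * w * 9
  252w≡28w*9 = solve-∀
  9∤3 : ¬ 9 ∣ 3
  9∤3 9∣3 with ∣⇒≤ 9∣3
  ... | s≤s (s≤s (s≤s ()))

n<3^n : ∀ n → n < 3 ^ n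
n<3^n zero    = s≤s z≤n
n<3^n (suc n) = ≤-<-trans (n<3^n n) (subst (3 ^ n <_) (*-comm (3 ^ n) 3) (m<m*n (3 ^ n) 3 {{m^n≢0 3 n}} (s≤s (s≤s z≤n))))

weak∖carmichael-unbounded : ∀ x → ∃ λ n → x < n × IsWeakCarmichael n × ¬ IsCarmichael n
weak∖carmichael-unbounded x =
  3 ^ suc (suc x) , <-≤-trans (n<3^n x) (^-monoʳ-≤ 3 (m≤n+m x 2)) , weakCarmichael-3^ x , ¬carmichael-3^ x

module CountSurplus {P Q : Pred ℕ 0ℓ} (P? : Decidable P) (Q? : Decidable Q) (P⊆Q : P ⊆ Q) where

  Surplus : ℕ → ℕ → Set
  Surplus x j = j + count P? x ≤ count Q? x

  surplus-suc : ∀ {x j} → Surplus x j → Surplus (suc x) j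
  surplus-suc {x} {j} s with P? (suc x) | Q? (suc x)
  ... | yes p | _     rewrite count-accept P? p | count-accept Q? (P⊆Q p) | +-suc j (count P? x) = s≤s s
  ... | no ¬p | yes q rewrite count-reject P? ¬p | count-accept Q? q = m≤n⇒m≤1+n s
  ... | no ¬p | no ¬q rewrite count-reject P? ¬p | count-reject Q? ¬q = s

  surplus-mono : ∀ {x y j} → x ≤ y → Surplus x j → Surplus y j
  surplus-mono x≤y = go (≤⇒≤′ x≤y)
    where
    go : ∀ {x y j} → x ≤′ y → Surplus x j → Surplus y j
    go ≤′-refl        s = s
    go (≤′-step x≤′y) s = surplus-suc (go x≤′y s)

  surplus-witness : ∀ {x j} → Q (suc x) → ¬ P (suc x) → Surplus x j → Surplus (suc x) (suc j)
  surplus-witness {x} {j} q ¬p s rewrite count-reject P? ¬p | count-accept Q? q = s≤s s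

  surplus-reached : (∀ x → ∃ λ y → x < y × Q y × ¬ P y) → ∀ j → ∃ λ N → Surplus N j
  surplus-reached witness zero = 0 , z≤n
  surplus-reached witness (suc j) with surplus-reached witness j
  ... | N , s with witness N
  ...   | suc y , s≤s N≤y , q , ¬p = suc y , surplus-witness q ¬p (surplus-mono N≤y s)

corollary2p22 : (isC? : Decidable IsCarmichael) (isW? : Decidable IsWeakCarmichael)
    → (M : ℤ) → ∃ λ (N : ℕ) → (x : ℕ) → N ≤ x
    → M ℤ.≤ (+ count isW? x) - (+ count isC? x)
corollary2p22 isC? isW? M =
  let N , surplus = surplus-reached weak∖carmichael-unbounded ∣ M ∣
  in N , λ x N≤x → ℤ.≤-trans (i≤+∣i∣ M) (m+n≤o⇒+m≤+o-+n (surplus-mono N≤x surplus))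
  where open CountSurplus isC? isW? carmichael⇒weakCarmichael
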